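{- Let $n,r$ be positive integers, $d=\gcd(r,n)$, $K_r=2^{2r}-2^r+1$, and let $e$ be the least positive residue of the inverse of $\frac rd$ modulo $\frac nd$. Let $a\in\{1,\dots,2^n-2\}$ with binary expansion $a=\sum_{m=0}^{n-1}\alpha_m2^m$, and define the $d\times\frac nd$ matrix $(a_{i,j})$ by $a_{i,j}=\alpha_{(i-jr)\bmod n}$ (so $a\equiv\sum_{i,j}a_{i,j}2^{i-jr}\pmod{2^n-1}$). The following are equivalent: (a) $a$ is the inverse of $K_r$ modulo $2^n-1$; (b) there exists a $d\times\frac nd$ matrix $(c_{i,j})$ with entries in $\{ -1,0,1\}$ such that $$2c_{0,0}-c_{d-1,e}+1=a_{0,2}-a_{0,1}+a_{0,0},$$ $$2c_{0,j}-c_{d-1,j+e}=a_{0,j+2}-a_{0,j+1}+a_{0,j}\quad\text{for all } j\in\{1,\dots,\tfrac nd-1\},$$ $$2c_{i,j}-c_{i-1,j}=a_{i,j+2}-a_{i,j+1}+a_{i,j}\quad\text{for all } i\in\{1,\dots,d-1\},\ j\in\{0,\dots,\tfrac nd-1\},$$ where column indices are taken modulo $\frac nd$. Moreover, the matrix $(c_{i,j})$ in (b) is unique.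
   Context: Powers $2^{m}$ with arbitrary integer $m$ are understood modulo $2^n-1$, i.e. $2^m=2^{m\bmod n}$. -}

module Defs where

open import Data.Nat using (ℕ; zero; suc; _+_; _*_; _∸_; _^_; _≤_; _<_)
open import Data.Nat.DivMod using (_/_; _%_)
open import Data.Nat.Properties using (m^n≢0)
open import Data.Nat.GCD using (gcd)
open import Data.Integer as ℤ using (ℤ; +_; -_)
open import Data.Integer.DivMod using (_%ℕ_)
open import Data.Sum using (_⊎_)
open import Data.Product using (_×_)
open import Relation.Binary.PropositionalEquality using (_≡_)

-- Total version of natural-number remainder (convention: x mod 0 = x;
-- only ever used with a positive modulus).
_mod_ : ℕ → ℕ → ℕ
x mod zero = x
x mod suc k = x % suc k

-- Total version of natural-number division (x div 0 = 0; only used with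
-- a positive divisor).
_div_ : ℕ → ℕ → ℕ
x div zero = 0
x div suc k = x / suc k

_zmod_ : ℤ → ℕ → ℕ
x zmod zero = 0
x zmod suc k = x %ℕ suc k

bit : ℕ → ℕ → ℕ
bit a m = _/_ a (2 ^ m) {{m^n≢0 2 m}} % 2

K : ℕ → ℕ
K r = 2 ^ (2 * r) ∸ 2 ^ r + 1

IsInverseOfK : (n r a : ℕ) → Set
IsInverseOfK n r a = (a * K r) mod (2 ^ n ∸ 1) ≡ 1 mod (2 ^ n ∸ 1)

entry : (n r a i j : ℕ) → ℤ
entry n r a i j = + bit a ((+ i ℤ.- + (j * r)) zmod n)

Trit : ℤ → Set
Trit x = x ≡ - (+ 1) ⊎ (x ≡ + 0 ⊎ x ≡ + 1)

-- Condition (b) for a matrix c (indexed by ℕ × ℕ; only 0 ≤ i < d,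
-- 0 ≤ j < n/d matter), with d = gcd r n, m = n/d, column indices mod m.
ConditionB : (n r e a : ℕ) → (ℕ → ℕ → ℤ) → Set
ConditionB n r e a c =
    (∀ i j → i < d → j < m → Trit (c i j))
  × ((+ 2 ℤ.* c 0 0 ℤ.- c (d ∸ 1) (e mod m) ℤ.+ + 1)
       ≡ A 0 (2 mod m) ℤ.- A 0 (1 mod m) ℤ.+ A 0 0)
  × (∀ j → 1 ≤ j → j < m →
       (+ 2 ℤ.* c 0 j ℤ.- c (d ∸ 1) ((j + e) mod m))
         ≡ A 0 ((j + 2) mod m) ℤ.- A 0 ((j + 1) mod m) ℤ.+ A 0 j)
  × (∀ i j → 1 ≤ i → i < d → j < m →
       (+ 2 ℤ.* c i j ℤ.- c (i ∸ 1) j)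
         ≡ A i ((j + 2) mod m) ℤ.- A i ((j + 1) mod m) ℤ.+ A i j)
  where
    d = gcd r n
    m = n div d
    A = entry n r a

-- Multiplying by 2^t modulo 2^n - 1 rotates binary digits, so if a has bits α_p then
-- a·K_r ≡ Σ β_p 2^p with β_p = α_{p-2r} - α_{p-r} + α_p ∈ {-1,…,2} (indices mod n).  Such a
-- digit string represents 1 modulo 2^n - 1 iff there are carries γ_p ∈ {-1,0,1} with
-- 2γ_p - γ_{p-1} = β_p - [p = 0] cyclically: one direction telescopes, for the other the
-- quotient κ of Σ β_p 2^p - 1 by 2^n - 1 is forced into {-1,0,1} by size, and the carries are
-- computed downwards from it.  Two carry sequences agree, since their difference doubles at each
-- step yet stays bounded.  Finally (i, j) ↦ i - j r mod n is a bijection from the d × n/d grid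
-- onto ℤ/n under which the cyclic predecessor becomes (i - 1, j), resp. (d - 1, j + e) for
-- i = 0, because e r ≡ d (mod n); this turns the carry equations into condition (b).

module Submission where

open import Defs

-- Integer arithmetic is opened only inside this module, so that the statement of theorem7 can
-- use the natural-number operators unqualified.
module Carrying where

  open import Data.Nat as ℕ using (ℕ; zero; suc; _∸_; z≤n; s≤s; NonZero)
  import Data.Nat.Properties as ℕP
  import Data.Nat.DivMod as ℕD
  import Data.Nat.Divisibility as ℕDiv
  open import Data.Nat.GCD using (gcd; gcd[m,n]∣m; gcd[m,n]∣n; gcd[m,n]≢0)
  open import Data.Integer as ℤ using (ℤ; 0ℤ; 1ℤ; -1ℤ; +_; _+_; _-_; _*_; -_; ∣_∣)
  import Data.Integer.Properties as ℤP
  open import Data.Integer.DivMod using (_%ℕ_; _/ℕ_; a≡a%ℕn+[a/ℕn]*n; n%ℕd<d)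
  open import Data.Integer.Divisibility.Signed
    using (_∣_; divides; ∣m∣n⇒∣m+n; ∣m⇒∣-m; ∣n⇒∣m*n; ∣-trans; *-monoˡ-∣; *-cancelʳ-∣; ∣⇒∣ᵤ)
  open import Data.Integer.Tactic.RingSolver using (solve-∀)
  open import Data.Product using (∃; _×_; _,_; proj₁; proj₂; uncurry)
  open import Data.Sum using (inj₁; inj₂)
  open import Data.Empty using (⊥-elim)
  open import Function using (_∘_)
  open import Function.Bundles using (_⇔_; mk⇔)
  open import Relation.Binary.Bundles using (Setoid)
  open import Relation.Binary.PropositionalEquality
  open import Relation.Nullary using (¬_)
  open import Relation.Nullary.Decidable using (True; toWitness)

  -- A record rather than an abbreviation of N ∣ x - y, so that x, y and N stay inferable.
  infix 4 _≡_[mod_]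
  record _≡_[mod_] (x y N : ℤ) : Set where
    constructor ∣⇒≡[mod]
    field ≡[mod]⇒∣ : N ∣ x - y
  open _≡_[mod_]

  module _ {N : ℤ} where

    ≡[mod]-reflexive : ∀ {x y} → x ≡ y → x ≡ y [mod N ]
    ≡[mod]-reflexive {x} refl = ∣⇒≡[mod] (divides (+ 0) (ℤP.+-inverseʳ x))

    ≡[mod]-refl : ∀ {x} → x ≡ x [mod N ]
    ≡[mod]-refl = ≡[mod]-reflexive refl

    ≡[mod]-sym : ∀ {x y} → x ≡ y [mod N ] → y ≡ x [mod N ]
    ≡[mod]-sym {x} {y} p = ∣⇒≡[mod] (subst (N ∣_) (lemma x y) (∣m⇒∣-m (≡[mod]⇒∣ p)))
      where lemma : ∀ x y → - (x - y) ≡ y - x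
            lemma = solve-∀

    ≡[mod]-trans : ∀ {x y z} → x ≡ y [mod N ] → y ≡ z [mod N ] → x ≡ z [mod N ]
    ≡[mod]-trans {x} {y} {z} p q = ∣⇒≡[mod] (subst (N ∣_) (lemma x y z) (∣m∣n⇒∣m+n (≡[mod]⇒∣ p) (≡[mod]⇒∣ q)))
      where lemma : ∀ x y z → (x - y) + (y - z) ≡ x - z
            lemma = solve-∀

    +-cong-mod : ∀ {x x′ y y′} → x ≡ x′ [mod N ] → y ≡ y′ [mod N ] → x + y ≡ x′ + y′ [mod N ]
    +-cong-mod {x} {x′} {y} {y′} p q =
      ∣⇒≡[mod] (subst (N ∣_) (lemma x x′ y y′) (∣m∣n⇒∣m+n (≡[mod]⇒∣ p) (≡[mod]⇒∣ q)))
      where lemma : ∀ x x′ y y′ → (x - x′) + (y - y′) ≡ (x + y) - (x′ + y′)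
            lemma = solve-∀

    neg-cong-mod : ∀ {x x′} → x ≡ x′ [mod N ] → - x ≡ - x′ [mod N ]
    neg-cong-mod {x} {x′} p = ∣⇒≡[mod] (subst (N ∣_) (lemma x x′) (∣m⇒∣-m (≡[mod]⇒∣ p)))
      where lemma : ∀ x x′ → - (x - x′) ≡ - x - - x′
            lemma = solve-∀

    -‿cong-mod : ∀ {x x′ y y′} → x ≡ x′ [mod N ] → y ≡ y′ [mod N ] → x - y ≡ x′ - y′ [mod N ]
    -‿cong-mod p q = +-cong-mod p (neg-cong-mod q)

    *-congˡ-mod : ∀ c {x x′} → x ≡ x′ [mod N ] → c * x ≡ c * x′ [mod N ]
    *-congˡ-mod c {x} {x′} p = ∣⇒≡[mod] (subst (N ∣_) (lemma c x x′) (∣n⇒∣m*n c (≡[mod]⇒∣ p)))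
      where lemma : ∀ c x x′ → c * (x - x′) ≡ c * x - c * x′
            lemma = solve-∀

    +-multiple-mod : ∀ x k → x + k * N ≡ x [mod N ]
    +-multiple-mod x k = ∣⇒≡[mod] (divides k (lemma x k N))
      where lemma : ∀ x k N → x + k * N - x ≡ k * N
            lemma = solve-∀

  *-distribʳ-- : ∀ x y d → (x - y) * d ≡ x * d - y * d
  *-distribʳ-- = solve-∀

  ≡[mod]-setoid : ℤ → Setoid _ _
  ≡[mod]-setoid N = record
    { Carrier = ℤ
    ; _≈_ = _≡_[mod N ]
    ; isEquivalence = record { refl = ≡[mod]-refl ; sym = ≡[mod]-sym ; trans = ≡[mod]-trans }
    }

  module ≡[mod]-Reasoning (N : ℤ) where
    open import Relation.Binary.Reasoning.Setoid (≡[mod]-setoid N) public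

  ≡[mod]-∣ : ∀ {M N x y} → M ∣ N → x ≡ y [mod N ] → x ≡ y [mod M ]
  ≡[mod]-∣ M∣N p = ∣⇒≡[mod] (∣-trans M∣N (≡[mod]⇒∣ p))

  *-monoʳ-mod : ∀ {m x y} d → x ≡ y [mod m ] → x * d ≡ y * d [mod m * d ]
  *-monoʳ-mod {m} {x} {y} d p = ∣⇒≡[mod] (subst (m * d ∣_) (*-distribʳ-- x y d) (*-monoˡ-∣ d (≡[mod]⇒∣ p)))

  *-cancelʳ-mod : ∀ {m x y} d .{{_ : ℤ.NonZero d}} → x * d ≡ y * d [mod m * d ] → x ≡ y [mod m ]
  *-cancelʳ-mod {m} {x} {y} d p = ∣⇒≡[mod] (*-cancelʳ-∣ d (subst (m * d ∣_) (sym (*-distribʳ-- x y d)) (≡[mod]⇒∣ p)))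

  zmod-≡ : ∀ n .{{_ : NonZero n}} x → + (x zmod n) ≡ x [mod + n ]
  zmod-≡ (suc k) x = ≡[mod]-sym (subst (_≡ + (x zmod suc k) [mod + suc k ])
    (sym (a≡a%ℕn+[a/ℕn]*n x (suc k))) (+-multiple-mod _ (x /ℕ suc k)))

  zmod-< : ∀ n .{{_ : NonZero n}} x → x zmod n ℕ.< n
  zmod-< (suc k) x = n%ℕd<d x (suc k)

  mod≡zmod : ∀ x n .{{_ : NonZero n}} → x mod n ≡ (+ x) zmod n
  mod≡zmod x (suc k) = refl

  ≡[mod]-small⇒≡ : ∀ {n u v} → u ℕ.< n → v ℕ.< n → + u ≡ + v [mod + n ] → u ≡ v
  ≡[mod]-small⇒≡ {n} {u} {v} u<n v<n p =
    ℤP.+-injective (ℤP.i-j≡0⇒i≡j (+ u) (+ v) (ℤP.∣i∣≡0⇒i≡0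
      (trans (sym (ℕD.m<n⇒m%n≡m ∣u-v∣<n)) (ℕDiv.n∣m⇒m%n≡0 _ n n∣∣u-v∣))))
    where
      instance _ = ℕ.>-nonZero (ℕP.≤-<-trans z≤n u<n)
      n∣∣u-v∣ : n ℕDiv.∣ ∣ + u - + v ∣
      n∣∣u-v∣ = ∣⇒∣ᵤ (≡[mod]⇒∣ p)
      ∣u-v∣<n : ∣ + u - + v ∣ ℕ.< n
      ∣u-v∣<n = subst (ℕ._< n) (sym (cong ∣_∣ (ℤP.[+m]-[+n]≡m⊖n u v)))
        (ℕP.≤-<-trans (ℤP.∣m⊝n∣≤m⊔n u v) (ℕP.⊔-lub u<n v<n))

  zmod-cong : ∀ n .{{_ : NonZero n}} {x y} → x ≡ y [mod + n ] → x zmod n ≡ y zmod n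
  zmod-cong n {x} {y} p = ≡[mod]-small⇒≡ (zmod-< n x) (zmod-< n y)
    (≡[mod]-trans (zmod-≡ n x) (≡[mod]-trans p (≡[mod]-sym (zmod-≡ n y))))

  zmod-unique : ∀ n .{{_ : NonZero n}} {x u} → u ℕ.< n → x ≡ + u [mod + n ] → x zmod n ≡ u
  zmod-unique n {u = u} u<n p = trans (zmod-cong n p) (≡[mod]-small⇒≡ (zmod-< n (+ u)) u<n (zmod-≡ n (+ u)))

  mod≡⇒≡[mod] : ∀ N .{{_ : NonZero N}} x y → x mod N ≡ y mod N → + x ≡ + y [mod + N ]
  mod≡⇒≡[mod] N x y eq = ≡[mod]-trans (≡[mod]-sym (zmod-≡ N (+ x)))
    (≡[mod]-trans (≡[mod]-reflexive (cong +_ (trans (sym (mod≡zmod x N)) (trans eq (mod≡zmod y N))))) (zmod-≡ N (+ y)))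

  mod-< : ∀ x N .{{_ : NonZero N}} → x mod N ℕ.< N
  mod-< x N = subst (ℕ._< N) (sym (mod≡zmod x N)) (zmod-< N (+ x))

  ≡[mod]⇒mod≡ : ∀ N .{{_ : NonZero N}} x y → + x ≡ + y [mod + N ] → x mod N ≡ y mod N
  ≡[mod]⇒mod≡ N x y p = trans (mod≡zmod x N) (trans (zmod-cong N p) (sym (mod≡zmod y N)))

  *-congʳ-mod : ∀ {N} c {x x′} → x ≡ x′ [mod N ] → x * c ≡ x′ * c [mod N ]
  *-congʳ-mod c {x} {x′} p = subst₂ (_≡_[mod _ ]) (ℤP.*-comm c x) (ℤP.*-comm c x′) (*-congˡ-mod c p)

  *-scale-mod : ∀ {m x y} c d → x ≡ y [mod m ] → x * (c * d) ≡ y * (c * d) [mod m * d ]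
  *-scale-mod {x = x} {y} c d p = subst₂ (_≡_[mod _ ]) (ℤP.*-assoc x c d) (ℤP.*-assoc y c d) (*-monoʳ-mod d (*-congʳ-mod c p))

  div-mul : ∀ x d .{{_ : NonZero d}} → d ℕDiv.∣ x → x ≡ x div d ℕ.* d
  div-mul x (suc k) d∣x = sym (ℕD.m/n*n≡m d∣x)

  pos-∸ : ∀ {m k} → k ℕ.≤ m → + (m ∸ k) ≡ + m - + k
  pos-∸ {m} {k} k≤m = sym (trans (ℤP.[+m]-[+n]≡m⊖n m k) (ℤP.⊖-≥ k≤m))

  2^ : ℕ → ℤ
  2^ p = (+ 2) ℤ.^ p

  binary : ℕ → (ℕ → ℤ) → ℤ
  binary zero f = + 0
  binary (suc k) f = binary k f + f k * 2^ k

  binary-cong : ∀ k {f g : ℕ → ℤ} → (∀ p → p ℕ.< k → f p ≡ g p) → binary k f ≡ binary k g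
  binary-cong zero _ = refl
  binary-cong (suc k) f≗g =
    cong₂ (λ x y → x + y * 2^ k) (binary-cong k (λ p p<k → f≗g p (ℕP.m<n⇒m<1+n p<k))) (f≗g k ℕP.≤-refl)

  binary-+ : ∀ k f g → binary k (λ p → f p + g p) ≡ binary k f + binary k g
  binary-+ zero f g = refl
  binary-+ (suc k) f g = trans (cong (_+ (f k + g k) * 2^ k) (binary-+ k f g)) (lemma (binary k f) (binary k g) (f k) (g k) (2^ k))
    where lemma : ∀ a b x y t → a + b + (x + y) * t ≡ a + x * t + (b + y * t)
          lemma = solve-∀

  binary-neg : ∀ k f → binary k (λ p → - f p) ≡ - binary k f
  binary-neg zero f = refl
  binary-neg (suc k) f = trans (cong (_+ - f k * 2^ k) (binary-neg k f)) (lemma (binary k f) (f k) (2^ k))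
    where lemma : ∀ a x t → - a + - x * t ≡ - (a + x * t)
          lemma = solve-∀

  binary-unshift : ∀ k f → binary (suc k) f ≡ f 0 + + 2 * binary k (λ p → f (suc p))
  binary-unshift zero f = lemma (f 0)
    where lemma : ∀ x → + 0 + x * + 1 ≡ x + + 2 * + 0
          lemma = solve-∀
  binary-unshift (suc k) f = trans (cong (_+ f (suc k) * 2^ (suc k)) (binary-unshift k f))
    (lemma (f 0) (binary k (λ p → f (suc p))) (f (suc k)) (2^ k))
    where lemma : ∀ a b x t → a + + 2 * b + x * (+ 2 * t) ≡ a + + 2 * (b + x * t)
          lemma = solve-∀

  binary-telescope : ∀ (g : ℕ → ℤ) t → binary t (λ p → + 2 * g (suc p) - g p) ≡ g t * 2^ t - g 0
  binary-telescope g zero = lemma (g 0)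
    where lemma : ∀ x → + 0 ≡ x * + 1 - x
          lemma = solve-∀
  binary-telescope g (suc t) = trans (cong (_+ (+ 2 * g (suc t) - g t) * 2^ t) (binary-telescope g t)) (lemma (g t) (g (suc t)) (2^ t) (g 0))
    where lemma : ∀ x y t z → x * t - z + (+ 2 * y - x) * t ≡ y * (+ 2 * t) - z
          lemma = solve-∀

  δ₀ : ℕ → ℤ
  δ₀ zero = + 1
  δ₀ (suc _) = + 0

  binary-δ₀ : ∀ k → binary (suc k) δ₀ ≡ + 1
  binary-δ₀ zero = refl
  binary-δ₀ (suc k) = trans (cong (_+ + 0 * 2^ (suc k)) (binary-δ₀ k)) (cong (_+_ 1ℤ) (ℤP.*-zeroˡ (2^ (suc k))))

  pos-2^ : ∀ k → + (2 ℕ.^ k) ≡ 2^ k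
  pos-2^ zero = refl
  pos-2^ (suc k) = trans (ℤP.pos-* 2 (2 ℕ.^ k)) (cong (+ 2 *_) (pos-2^ k))

  private
    _/2^_ : ℕ → ℕ → ℕ
    a /2^ m = ℕD._/_ a (2 ℕ.^ m) {{ℕP.m^n≢0 2 m}}

    /2^-suc : ∀ a m → a /2^ m ≡ bit a m ℕ.+ a /2^ suc m ℕ.* 2
    /2^-suc a m = trans (ℕD.m≡m%n+[m/n]*n (a /2^ m) 2) (cong (λ q → bit a m ℕ.+ q ℕ.* 2) halve)
      where
        instance
          _ = ℕP.m^n≢0 2 m
          _ = ℕP.m^n≢0 2 (suc m)
          _ = ℕP.m*n≢0 (2 ℕ.^ m) 2
        halve : ℕD._/_ (a /2^ m) 2 ≡ a /2^ suc m
        halve = trans (ℕD.m/n/o≡m/[n*o] a (2 ℕ.^ m) 2) (ℕD./-congʳ (ℕP.*-comm (2 ℕ.^ m) 2))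

    binary-bits+ : ∀ a k → + a ≡ binary k (λ p → + bit a p) + 2^ k * + (a /2^ k)
    binary-bits+ a zero = trans (cong +_ (sym (ℕD.n/1≡n a))) (lemma (+ (a /2^ 0)))
      where lemma : ∀ x → x ≡ + 0 + + 1 * x
            lemma = solve-∀
    binary-bits+ a (suc k) = begin
        + a                                                                  ≡⟨ binary-bits+ a k ⟩
        binary k α + 2^ k * + (a /2^ k)                                      ≡⟨ cong (λ q → binary k α + 2^ k * q) split ⟩
        binary k α + 2^ k * (+ bit a k + + (a /2^ suc k) * + 2)              ≡⟨ lemma (binary k α) (2^ k) (+ bit a k) (+ (a /2^ suc k)) ⟩
        binary (suc k) α + 2^ (suc k) * + (a /2^ suc k)                      ∎
      where
        open ≡-Reasoning
        α = λ p → + bit a p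
        split : + (a /2^ k) ≡ + bit a k + + (a /2^ suc k) * + 2
        split = trans (cong +_ (/2^-suc a k)) (trans (ℤP.pos-+ (bit a k) _) (cong (_+_ (+ bit a k)) (ℤP.pos-* (a /2^ suc k) 2)))
        lemma : ∀ s t b q → s + t * (b + q * + 2) ≡ s + b * t + + 2 * t * q
        lemma = solve-∀

  binary-bits : ∀ {a} k → a ℕ.< 2 ℕ.^ k → + a ≡ binary k (λ p → + bit a p)
  binary-bits {a} k a<2^k = trans (binary-bits+ a k) (trans (cong (λ q → binary k (λ p → + bit a p) + 2^ k * + q) a/2^k≡0)
    (trans (cong (_+_ (binary k (λ p → + bit a p))) (ℤP.*-zeroʳ (2^ k))) (ℤP.+-identityʳ _)))
    where a/2^k≡0 = ℕD.m<n⇒m/n≡0 {{ℕP.m^n≢0 2 k}} a<2^k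

  prev : ℕ → ℕ → ℕ
  prev n p = (+ p - + 1) zmod n

  prev-zero : ∀ k → prev (suc k) 0 ≡ k
  prev-zero k = zmod-unique (suc k) {+ 0 - + 1} ℕP.≤-refl (∣⇒≡[mod] (divides (- 1ℤ) (lemma (+ k))))
    where lemma : ∀ x → + 0 - + 1 - x ≡ - 1ℤ * (+ 1 + x)
          lemma = solve-∀

  prev-suc : ∀ n .{{_ : NonZero n}} {p} → suc p ℕ.< n → prev n (suc p) ≡ p
  prev-suc n {p} p<n = zmod-unique n (ℕP.<-trans (ℕP.n<1+n p) p<n) (≡[mod]-reflexive (lemma (+ p)))
    where lemma : ∀ x → + 1 + x - + 1 ≡ x
          lemma = solve-∀

  binary-prev : ∀ k f → binary (suc k) (λ p → f (prev (suc k) p)) ≡ + 2 * binary (suc k) f [mod 2^ (suc k) - 1ℤ ]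
  binary-prev k f = ∣⇒≡[mod] (divides (- f k) (begin
      binary (suc k) (λ p → f (prev (suc k) p)) - + 2 * binary (suc k) f
        ≡⟨ cong (_- + 2 * binary (suc k) f) (binary-unshift k (λ p → f (prev (suc k) p))) ⟩
      f (prev (suc k) 0) + + 2 * binary k (λ p → f (prev (suc k) (suc p))) - + 2 * binary (suc k) f
        ≡⟨ cong₂ (λ x y → f x + + 2 * y - + 2 * binary (suc k) f)
             (prev-zero k) (binary-cong k (λ p p<k → cong f (prev-suc (suc k) (s≤s p<k)))) ⟩
      f k + + 2 * binary k f - + 2 * (binary k f + f k * 2^ k)
        ≡⟨ lemma (f k) (binary k f) (2^ k) ⟩
      - f k * (2^ (suc k) - 1ℤ) ∎))
    where
      open ≡-Reasoning
      lemma : ∀ x b t → x + + 2 * b - + 2 * (b + x * t) ≡ - x * (+ 2 * t - 1ℤ)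
      lemma = solve-∀

  binary-rotate : ∀ n .{{_ : NonZero n}} t f → binary n (λ p → f ((+ p - + t) zmod n)) ≡ 2^ t * binary n f [mod 2^ n - 1ℤ ]
  binary-rotate n zero f = ≡[mod]-reflexive (trans
    (binary-cong n (λ p p<n → cong f (zmod-unique n p<n (≡[mod]-reflexive (ℤP.+-identityʳ (+ p))))))
    (sym (ℤP.*-identityˡ _)))
  binary-rotate n@(suc k) (suc t) f = begin
      binary n (λ p → f ((+ p - + suc t) zmod n))  ≡⟨ binary-cong n (λ p _ → cong f (zmod-cong n (shift p))) ⟩
      binary n (λ p → h (prev n p))                ≈⟨ binary-prev k h ⟩
      + 2 * binary n h                             ≈⟨ *-congˡ-mod (+ 2) (binary-rotate n t f) ⟩
      + 2 * (2^ t * binary n f)                    ≡⟨ ℤP.*-assoc (+ 2) (2^ t) (binary n f) ⟨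
      2^ (suc t) * binary n f                      ∎
    where
      open ≡[mod]-Reasoning (2^ n - 1ℤ)
      h = λ q → f ((+ q - + t) zmod n)
      shift : ∀ p → + p - + suc t ≡ + prev n p - + t [mod + n ]
      shift p = ≡[mod]-sym (≡[mod]-trans (-‿cong-mod (zmod-≡ n (+ p - + 1)) ≡[mod]-refl) (≡[mod]-reflexive (lemma (+ p) (+ t))))
        where lemma : ∀ x t → x - + 1 - t ≡ x - (+ 1 + t)
              lemma = solve-∀

  2^-nonNegative : ∀ t → ℤ.NonNegative (2^ t)
  2^-nonNegative t = ℤ.nonNegative (subst (0ℤ ℤ.≤_) (pos-2^ t) (ℤ.+≤+ z≤n))

  binary-bounds : ∀ t (lo hi : ℤ) f → (∀ p → p ℕ.< t → lo ℤ.≤ f p × f p ℤ.≤ hi) →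
                  lo * (2^ t - 1ℤ) ℤ.≤ binary t f × binary t f ℤ.≤ hi * (2^ t - 1ℤ)
  binary-bounds zero lo hi f _ = ℤP.≤-reflexive (ℤP.*-zeroʳ lo) , ℤP.≤-reflexive (sym (ℤP.*-zeroʳ hi))
  binary-bounds (suc t) lo hi f bounded =
      ℤP.≤-trans (ℤP.≤-reflexive (split lo)) (ℤP.+-mono-≤ (proj₁ ih) (scale (proj₁ (bounded t ℕP.≤-refl))))
    , ℤP.≤-trans (ℤP.+-mono-≤ (proj₂ ih) (scale (proj₂ (bounded t ℕP.≤-refl)))) (ℤP.≤-reflexive (sym (split hi)))
    where
      scale : ∀ {x y} → x ℤ.≤ y → x * 2^ t ℤ.≤ y * 2^ t
      scale = ℤP.*-monoʳ-≤-nonNeg (2^ t) {{2^-nonNegative t}}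
      ih = binary-bounds t lo hi f (λ p p<t → bounded p (ℕP.m<n⇒m<1+n p<t))
      split : ∀ c → c * (2^ (suc t) - 1ℤ) ≡ c * (2^ t - 1ℤ) + c * 2^ t
      split c = lemma c (2^ t)
        where lemma : ∀ c x → c * (+ 2 * x - 1ℤ) ≡ c * (x - 1ℤ) + c * x
              lemma = solve-∀

  Trit⇒bounds : ∀ {x} → Trit x → -1ℤ ℤ.≤ x × x ℤ.≤ 1ℤ
  Trit⇒bounds (inj₁ refl) = ℤP.≤-refl , ℤ.-≤+
  Trit⇒bounds (inj₂ (inj₁ refl)) = ℤ.-≤+ , ℤ.+≤+ z≤n
  Trit⇒bounds (inj₂ (inj₂ refl)) = ℤ.-≤+ , ℤP.≤-refl

  bounds⇒Trit : ∀ {x} → ℤ.-[1+ 1 ] ℤ.< x → x ℤ.< + 2 → Trit x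
  bounds⇒Trit {+ zero} _ _ = inj₂ (inj₁ refl)
  bounds⇒Trit {+ suc zero} _ _ = inj₂ (inj₂ refl)
  bounds⇒Trit {+ suc (suc _)} _ (ℤ.+<+ (s≤s (s≤s ())))
  bounds⇒Trit { ℤ.-[1+ zero ]} _ _ = inj₁ refl
  bounds⇒Trit { ℤ.-[1+ suc _ ]} (ℤ.-<- (s≤s ())) _

  bounds⇒≡0 : ∀ {x} → -1ℤ ℤ.< x → x ℤ.< 1ℤ → x ≡ 0ℤ
  bounds⇒≡0 {+ zero} _ _ = refl
  bounds⇒≡0 {+ suc _} _ (ℤ.+<+ (s≤s ()))
  bounds⇒≡0 { ℤ.-[1+ _ ]} (ℤ.-<- ()) _

  -- γ p is the carry out of bit p when the digits b p (p < n) are reduced, cyclically, to 1.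
  record Carries (n : ℕ) (b γ : ℕ → ℤ) : Set where
    field
      trit : ∀ p → p ℕ.< n → Trit (γ p)
      step : ∀ p → p ℕ.< n → + 2 * γ p - γ (prev n p) ≡ b p - δ₀ p

  binary-δ₀-shift : ∀ k b → binary (suc k) (λ p → b p - δ₀ p) ≡ binary (suc k) b - 1ℤ
  binary-δ₀-shift k b = trans (binary-+ (suc k) b (λ p → - δ₀ p))
    (cong (_+_ (binary (suc k) b)) (trans (binary-neg (suc k) δ₀) (cong -_ (binary-δ₀ k))))

  carries⇒≡1 : ∀ k b γ → Carries (suc k) b γ → binary (suc k) b ≡ 1ℤ [mod 2^ (suc k) - 1ℤ ]
  carries⇒≡1 k b γ carries = ∣⇒≡[mod] (divides (γ k) (begin
      binary n b - 1ℤ                          ≡⟨ binary-δ₀-shift k b ⟨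
      binary n (λ p → b p - δ₀ p)              ≡⟨ binary-cong n (λ p p<n → sym (step′ p p<n)) ⟩
      binary n (λ p → + 2 * g (suc p) - g p)   ≡⟨ binary-telescope g n ⟩
      γ k * 2^ n - γ k                         ≡⟨ lemma (γ k) (2^ n) ⟩
      γ k * (2^ n - 1ℤ)                        ∎))
    where
      open ≡-Reasoning
      open Carries carries
      n = suc k
      g : ℕ → ℤ
      g zero = γ k
      g (suc p) = γ p
      step′ : ∀ p → p ℕ.< n → + 2 * g (suc p) - g p ≡ b p - δ₀ p
      step′ zero p<n = subst (λ q → + 2 * γ 0 - γ q ≡ b 0 - 1ℤ) (prev-zero k) (step 0 p<n)
      step′ (suc p) p<n = subst (λ q → + 2 * γ (suc p) - γ q ≡ b (suc p) - 0ℤ) (prev-suc n p<n) (step (suc p) p<n)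
      lemma : ∀ c t → c * t - c ≡ c * (t - 1ℤ)
      lemma = solve-∀

  prev-surjective : ∀ n .{{_ : NonZero n}} {q} → q ℕ.< n → ∃ λ p → p ℕ.< n × prev n p ≡ q
  prev-surjective n {q} q<n = (+ suc q) zmod n , zmod-< n (+ suc q) ,
    zmod-unique n q<n (≡[mod]-trans (-‿cong-mod {y = + 1} (zmod-≡ n (+ suc q)) ≡[mod]-refl) (≡[mod]-reflexive (lemma (+ q))))
    where lemma : ∀ x → + 1 + x - + 1 ≡ x
          lemma = solve-∀

  carries-unique : ∀ n .{{_ : NonZero n}} {b γ γ′} → Carries n b γ → Carries n b γ′ → ∀ q → q ℕ.< n → γ q ≡ γ′ q
  carries-unique n {b} {γ} {γ′} carries carries′ q q<n = ℤP.i-j≡0⇒i≡j (γ q) (γ′ q) (begin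
      D q                ≡⟨ doubling-twice ⟩
      + 4 * D p′         ≡⟨ cong (+ 4 *_) D[p′]≡0 ⟩
      0ℤ                 ∎)
    where
      open ≡-Reasoning
      open Carries
      D : ℕ → ℤ
      D x = γ x - γ′ x
      D-prev : ∀ {p} → p ℕ.< n → D (prev n p) ≡ + 2 * D p
      D-prev {p} p<n = lemma (γ p) (γ (prev n p)) (γ′ p) (γ′ (prev n p)) (trans (step carries p p<n) (sym (step carries′ p p<n)))
        where
          lemma : ∀ x x⁻ y y⁻ → + 2 * x - x⁻ ≡ + 2 * y - y⁻ → x⁻ - y⁻ ≡ + 2 * (x - y)
          lemma x x⁻ y y⁻ eq = trans (rearrange x x⁻ y y⁻)
            (trans (cong (λ z → + 2 * (x - y) - z + (+ 2 * y - y⁻)) eq) (cancel x y y⁻))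
            where rearrange : ∀ x x⁻ y y⁻ → x⁻ - y⁻ ≡ + 2 * (x - y) - (+ 2 * x - x⁻) + (+ 2 * y - y⁻)
                  rearrange = solve-∀
                  cancel : ∀ x y y⁻ → + 2 * (x - y) - (+ 2 * y - y⁻) + (+ 2 * y - y⁻) ≡ + 2 * (x - y)
                  cancel = solve-∀
      D-bounds : ∀ {x} → x ℕ.< n → ℤ.-[1+ 1 ] ℤ.≤ D x × D x ℤ.≤ + 2
      D-bounds {x} x<n = ℤP.+-mono-≤ (proj₁ t) (ℤP.neg-mono-≤ (proj₂ t′))
                       , ℤP.+-mono-≤ (proj₂ t) (ℤP.neg-mono-≤ (proj₁ t′))
        where t = Trit⇒bounds (trit carries x x<n)
              t′ = Trit⇒bounds (trit carries′ x x<n)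
      p-prev = prev-surjective n q<n
      p = proj₁ p-prev
      p′-prev = prev-surjective n (proj₁ (proj₂ p-prev))
      p′ = proj₁ p′-prev
      doubling-twice : D q ≡ + 4 * D p′
      doubling-twice = begin
        D q                 ≡⟨ cong D (proj₂ (proj₂ p-prev)) ⟨
        D (prev n p)        ≡⟨ D-prev (proj₁ (proj₂ p-prev)) ⟩
        + 2 * D p           ≡⟨ cong (λ x → + 2 * D x) (proj₂ (proj₂ p′-prev)) ⟨
        + 2 * D (prev n p′) ≡⟨ cong (+ 2 *_) (D-prev (proj₁ (proj₂ p′-prev))) ⟩
        + 2 * (+ 2 * D p′)  ≡⟨ ℤP.*-assoc (+ 2) (+ 2) (D p′) ⟨
        + 4 * D p′          ∎
      D[p′]≡0 : D p′ ≡ 0ℤ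
      D[p′]≡0 = bounds⇒≡0
        (ℤP.*-cancelˡ-<-nonNeg (+ 4) (ℤP.<-≤-trans (ℤ.-<- (s≤s (s≤s z≤n)))
          (subst (ℤ.-[1+ 1 ] ℤ.≤_) doubling-twice (proj₁ (D-bounds q<n)))))
        (ℤP.*-cancelˡ-<-nonNeg (+ 4) (ℤP.≤-<-trans
          (subst (ℤ._≤ + 2) doubling-twice (proj₂ (D-bounds q<n))) (ℤ.+<+ (s≤s (s≤s (s≤s z≤n))))))

  halve-Trit : ∀ {u x y} → ℤ.-[1+ 1 ] ℤ.≤ u → u ℤ.≤ + 2 → Trit x → + 2 * y ≡ u + x → Trit y
  halve-Trit {u} {x} {y} -2≤u u≤2 x-trit eq = bounds⇒Trit
    (ℤP.*-cancelˡ-<-nonNeg (+ 2) (begin-strict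
      ℤ.-[1+ 3 ]          <⟨ ℤ.-<- (s≤s (s≤s (s≤s z≤n))) ⟩
      ℤ.-[1+ 1 ] + -1ℤ    ≤⟨ ℤP.+-mono-≤ -2≤u (proj₁ x-bounds) ⟩
      u + x               ≡⟨ eq ⟨
      + 2 * y             ∎))
    (ℤP.*-cancelˡ-<-nonNeg (+ 2) (begin-strict
      + 2 * y             ≡⟨ eq ⟩
      u + x               ≤⟨ ℤP.+-mono-≤ u≤2 (proj₂ x-bounds) ⟩
      + 3                 <⟨ ℤ.+<+ (s≤s (s≤s (s≤s (s≤s z≤n)))) ⟩
      + 4                 ∎))
    where
      open ℤP.≤-Reasoning
      x-bounds = Trit⇒bounds x-trit

  module CarryConstruction (k : ℕ) (b : ℕ → ℤ) (1≤k : 1 ℕ.≤ k)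
                           (digit : ∀ p → p ℕ.< suc k → -1ℤ ℤ.≤ b p × b p ℤ.≤ + 2)
                           (≡1 : binary (suc k) b ≡ 1ℤ [mod 2^ (suc k) - 1ℤ ]) where

    n = suc k
    M = 2^ n - 1ℤ
    S = binary n b

    3≤M : + 3 ℤ.≤ M
    3≤M = ℤP.+-monoˡ-≤ -1ℤ (subst (+ 4 ℤ.≤_) (pos-2^ n) (ℤ.+≤+ (ℕP.^-monoʳ-≤ 2 (s≤s 1≤k))))

    instance
      M-nonNegative : ℤ.NonNegative M
      M-nonNegative = ℤ.nonNegative (ℤP.≤-trans (ℤ.+≤+ z≤n) 3≤M)

    κ : ℤ
    κ = _∣_.quotient (≡[mod]⇒∣ ≡1)

    S-1≡κ*M : S - 1ℤ ≡ κ * M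
    S-1≡κ*M = _∣_.equality (≡[mod]⇒∣ ≡1)

    S-bounds : -1ℤ * M ℤ.≤ S × S ℤ.≤ + 2 * M
    S-bounds = binary-bounds n -1ℤ (+ 2) b digit

    κ-Trit : Trit κ
    κ-Trit = bounds⇒Trit
      (ℤP.*-cancelʳ-<-nonNeg M (begin-strict
        ℤ.-[1+ 1 ] * M      ≡⟨ lemma M ⟩
        -1ℤ * M + - M       <⟨ ℤP.+-monoʳ-< (-1ℤ * M) (ℤP.neg-mono-< (ℤP.<-≤-trans (ℤ.+<+ (s≤s (s≤s z≤n))) 3≤M)) ⟩
        -1ℤ * M + -1ℤ       ≤⟨ ℤP.+-monoˡ-≤ -1ℤ (proj₁ S-bounds) ⟩
        S - 1ℤ              ≡⟨ S-1≡κ*M ⟩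
        κ * M               ∎))
      (ℤP.*-cancelʳ-<-nonNeg M (begin-strict
        κ * M               ≡⟨ S-1≡κ*M ⟨
        S - 1ℤ              <⟨ ℤP.+-mono-≤-< (proj₂ S-bounds) (ℤ.-<+ {0} {0}) ⟩
        + 2 * M + 0ℤ        ≡⟨ ℤP.+-identityʳ (+ 2 * M) ⟩
        + 2 * M             ∎))
      where
        open ℤP.≤-Reasoning
        lemma : ∀ x → ℤ.-[1+ 1 ] * x ≡ -1ℤ * x + - x
        lemma = solve-∀

    u : ℕ → ℤ
    u p = b p - δ₀ p

    u-bounds : ∀ p → p ℕ.< n → ℤ.-[1+ 1 ] ℤ.≤ u p × u p ℤ.≤ + 2
    u-bounds p p<n = ℤP.+-mono-≤ (proj₁ (digit p p<n)) (ℤP.neg-mono-≤ (δ₀≤1 p))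
                   , ℤP.+-mono-≤ (proj₂ (digit p p<n)) (ℤP.neg-mono-≤ (0≤δ₀ p))
      where
        δ₀≤1 : ∀ p → δ₀ p ℤ.≤ 1ℤ
        δ₀≤1 zero = ℤP.≤-refl
        δ₀≤1 (suc _) = ℤ.+≤+ z≤n
        0≤δ₀ : ∀ p → 0ℤ ℤ.≤ δ₀ p
        0≤δ₀ zero = ℤ.+≤+ z≤n
        0≤δ₀ (suc _) = ℤP.≤-refl

    -- The carries are computed from the top, g n = κ; telescoping then gives g 0 = κ as well,
    -- which closes the cycle.
    downward : ℕ → ℤ
    downward zero = κ
    downward (suc t) = + 2 * downward t - u (n ∸ suc t)

    g : ℕ → ℤ
    g p = downward (n ∸ p)

    g-step : ∀ p → p ℕ.< n → + 2 * g (suc p) - g p ≡ u p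
    g-step p p<n = trans (cong (λ x → + 2 * g (suc p) - x) g≡) (lemma (+ 2 * g (suc p)) (u p))
      where
        n∸p≡ : n ∸ p ≡ suc (n ∸ suc p)
        n∸p≡ = ℕP.+-∸-assoc 1 p<n
        g≡ : g p ≡ + 2 * g (suc p) - u p
        g≡ = trans (cong downward n∸p≡) (cong (λ q → + 2 * g (suc p) - u q)
               (trans (cong (n ∸_) (sym n∸p≡)) (ℕP.m∸[m∸n]≡n (ℕP.<⇒≤ p<n))))
        lemma : ∀ x y → x - (x - y) ≡ y
        lemma = solve-∀

    g-top : g n ≡ κ
    g-top = cong downward (ℕP.n∸n≡0 n)

    g-bottom : g 0 ≡ κ
    g-bottom = begin
      g 0                              ≡⟨ lemma (g 0) (g n * 2^ n) ⟩
      g n * 2^ n - (g n * 2^ n - g 0)  ≡⟨ cong (λ x → g n * 2^ n - x) telescoped ⟩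
      g n * 2^ n - κ * M               ≡⟨ cong (λ x → x * 2^ n - κ * M) g-top ⟩
      κ * 2^ n - κ * M                 ≡⟨ cancel κ (2^ n) ⟩
      κ                                ∎
      where
        open ≡-Reasoning
        telescoped : g n * 2^ n - g 0 ≡ κ * M
        telescoped = trans (sym (binary-telescope g n))
          (trans (binary-cong n g-step) (trans (binary-δ₀-shift k b) S-1≡κ*M))
        lemma : ∀ x y → x ≡ y - (y - x)
        lemma = solve-∀
        cancel : ∀ x t → x * t - x * (t - 1ℤ) ≡ x
        cancel = solve-∀

    g-Trit : ∀ p → p ℕ.≤ n → Trit (g p)
    g-Trit zero _ = subst Trit (sym g-bottom) κ-Trit
    g-Trit (suc p) p<n = halve-Trit (proj₁ (u-bounds p p<n)) (proj₂ (u-bounds p p<n)) (g-Trit p (ℕP.<⇒≤ p<n))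
      (lemma (g (suc p)) (g p) (u p) (g-step p p<n))
      where lemma : ∀ y x u → + 2 * y - x ≡ u → + 2 * y ≡ u + x
            lemma y x u eq = trans (rearrange y x) (cong (_+ x) eq)
              where rearrange : ∀ y x → + 2 * y ≡ + 2 * y - x + x
                    rearrange = solve-∀

    g-prev : ∀ p → p ℕ.< n → g (suc (prev n p)) ≡ g p
    g-prev zero _ = trans (cong (g ∘ suc) (prev-zero k)) (trans g-top (sym g-bottom))
    g-prev (suc p) p<n = cong (g ∘ suc) (prev-suc n p<n)

    carries : Carries n b (g ∘ suc)
    carries = record
      { trit = λ p p<n → g-Trit (suc p) p<n
      ; step = λ p p<n → trans (cong (λ x → + 2 * g (suc p) - x) (g-prev p p<n)) (g-step p p<n)
      }

  ≡1⇒carries : ∀ k b → 1 ℕ.≤ k → (∀ p → p ℕ.< suc k → -1ℤ ℤ.≤ b p × b p ℤ.≤ + 2) →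
               binary (suc k) b ≡ 1ℤ [mod 2^ (suc k) - 1ℤ ] → ∃ (Carries (suc k) b)
  ≡1⇒carries k b 1≤k digit ≡1 = _ , CarryConstruction.carries k b 1≤k digit ≡1

  -- The coefficient of 2^p in a·2^{2r} - a·2^r + a after reducing exponents modulo n.
  aK-digit : (n r a p : ℕ) → ℤ
  aK-digit n r a p = + bit a ((+ p - + (2 ℕ.* r)) zmod n) - + bit a ((+ p - + r) zmod n) + + bit a p

  bit<2 : ∀ a p → bit a p ℕ.< 2
  bit<2 a p = ℕD.m%n<n (ℕD._/_ a (2 ℕ.^ p) {{ℕP.m^n≢0 2 p}}) 2

  aK-digit-bounds : ∀ n r a p → -1ℤ ℤ.≤ aK-digit n r a p × aK-digit n r a p ℤ.≤ + 2
  aK-digit-bounds n r a p = bounds (bit<2 a ((+ p - + (2 ℕ.* r)) zmod n)) (bit<2 a ((+ p - + r) zmod n)) (bit<2 a p)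
    where
      decide : ∀ {i j} → {True (i ℤ.≤? j)} → i ℤ.≤ j
      decide {i} {j} {i≤j} = toWitness i≤j
      bounds : ∀ {x y z} → x ℕ.< 2 → y ℕ.< 2 → z ℕ.< 2 → -1ℤ ℤ.≤ + x - + y + + z × + x - + y + + z ℤ.≤ + 2
      bounds {0} {0} {0} _ _ _ = decide , decide
      bounds {0} {0} {1} _ _ _ = decide , decide
      bounds {0} {1} {0} _ _ _ = decide , decide
      bounds {0} {1} {1} _ _ _ = decide , decide
      bounds {1} {0} {0} _ _ _ = decide , decide
      bounds {1} {0} {1} _ _ _ = decide , decide
      bounds {1} {1} {0} _ _ _ = decide , decide
      bounds {1} {1} {1} _ _ _ = decide , decide
      bounds {suc (suc _)} (s≤s (s≤s ())) _ _
      bounds {y = suc (suc _)} _ (s≤s (s≤s ())) _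
      bounds {z = suc (suc _)} _ _ (s≤s (s≤s ()))

  binary-aK-digit : ∀ n .{{_ : NonZero n}} r {a} → a ℕ.< 2 ℕ.^ n →
                    binary n (aK-digit n r a) ≡ + a * (2^ (2 ℕ.* r) - 2^ r + 1ℤ) [mod 2^ n - 1ℤ ]
  binary-aK-digit n r {a} a<2^n = begin
      binary n (aK-digit n r a)                                  ≡⟨ split ⟩
      binary n (rotated (2 ℕ.* r)) - binary n (rotated r) + A
        ≈⟨ +-cong-mod (-‿cong-mod (binary-rotate n (2 ℕ.* r) α) (binary-rotate n r α)) (≡[mod]-refl {x = A}) ⟩
      2^ (2 ℕ.* r) * A - 2^ r * A + A                            ≡⟨ cong (λ x → 2^ (2 ℕ.* r) * x - 2^ r * x + x) (binary-bits n a<2^n) ⟨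
      2^ (2 ℕ.* r) * + a - 2^ r * + a + + a                      ≡⟨ lemma (2^ (2 ℕ.* r)) (2^ r) (+ a) ⟩
      + a * (2^ (2 ℕ.* r) - 2^ r + 1ℤ)                           ∎
    where
      open ≡[mod]-Reasoning (2^ n - 1ℤ)
      α = λ p → + bit a p
      A = binary n α
      rotated = λ t p → α ((+ p - + t) zmod n)
      split : binary n (aK-digit n r a) ≡ binary n (rotated (2 ℕ.* r)) - binary n (rotated r) + A
      split = trans (binary-+ n (λ p → rotated (2 ℕ.* r) p - rotated r p) α)
        (cong (_+ A) (trans (binary-+ n (rotated (2 ℕ.* r)) (λ p → - rotated r p))
          (cong (_+_ (binary n (rotated (2 ℕ.* r)))) (binary-neg n (rotated r)))))
      lemma : ∀ x y a → x * a - y * a + a ≡ a * (x - y + 1ℤ)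
      lemma = solve-∀

  isInverseOfK⇔ : ∀ n .{{_ : NonZero n}} r {a} → a ℕ.< 2 ℕ.^ n →
                  IsInverseOfK n r a ⇔ binary n (aK-digit n r a) ≡ 1ℤ [mod 2^ n - 1ℤ ]
  isInverseOfK⇔ n r {a} a<2^n = mk⇔
    (λ inverse → ≡[mod]-trans (binary-aK-digit n r a<2^n)
       (subst₂ (λ x N → x ≡ 1ℤ [mod N ]) +aK≡ +N≡ (mod≡⇒≡[mod] N (a ℕ.* K r) 1 inverse)))
    (λ ≡1 → ≡[mod]⇒mod≡ N (a ℕ.* K r) 1 (subst₂ (λ x N → x ≡ 1ℤ [mod N ]) (sym +aK≡) (sym +N≡)
              (≡[mod]-trans (≡[mod]-sym (binary-aK-digit n r a<2^n)) ≡1)))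
    where
      N = 2 ℕ.^ n ∸ 1
      2≤2^n : 2 ℕ.≤ 2 ℕ.^ n
      2≤2^n = ℕP.^-monoʳ-≤ 2 {1} {n} (ℕ.>-nonZero⁻¹ n)
      instance
        N-nonZero : NonZero N
        N-nonZero = ℕ.>-nonZero (ℕP.∸-monoˡ-< 2≤2^n ℕP.≤-refl)
      +N≡ : + N ≡ 2^ n - 1ℤ
      +N≡ = trans (pos-∸ (ℕP.<⇒≤ 2≤2^n)) (cong (_- 1ℤ) (pos-2^ n))
      +aK≡ : + (a ℕ.* K r) ≡ + a * (2^ (2 ℕ.* r) - 2^ r + 1ℤ)
      +aK≡ = trans (ℤP.pos-* a (K r)) (cong (+ a *_) (trans (ℤP.pos-+ (2 ℕ.^ (2 ℕ.* r) ∸ 2 ℕ.^ r) 1)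
        (cong (_+ 1ℤ) (trans (pos-∸ (ℕP.^-monoʳ-≤ 2 (ℕP.m≤n*m r 2))) (cong₂ _-_ (pos-2^ (2 ℕ.* r)) (pos-2^ r))))))

  module Grid (n r e a : ℕ) {{_ : NonZero n}}
              (e-inverse : (e ℕ.* (r div gcd r n)) mod (n div gcd r n) ≡ 1 mod (n div gcd r n)) where

    d = gcd r n
    m = n div d
    r′ = r div d

    instance
      d-nonZero : NonZero d
      d-nonZero = ℕ.≢-nonZero (gcd[m,n]≢0 r n (inj₂ (ℕ.≢-nonZero⁻¹ n)))

    n≡m*d : n ≡ m ℕ.* d
    n≡m*d = div-mul n d (gcd[m,n]∣n r n)

    r≡r′*d : r ≡ r′ ℕ.* d
    r≡r′*d = div-mul r d (gcd[m,n]∣m r n)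

    instance
      m-nonZero : NonZero m
      m-nonZero = ℕ.≢-nonZero λ m≡0 → ℕ.≢-nonZero⁻¹ n (trans n≡m*d (cong (ℕ._* d) m≡0))

    +n≡+m*+d : + n ≡ + m * + d
    +n≡+m*+d = trans (cong +_ n≡m*d) (ℤP.pos-* m d)

    +r≡+r′*+d : + r ≡ + r′ * + d
    +r≡+r′*+d = trans (cong +_ r≡r′*d) (ℤP.pos-* r′ d)

    *r-cong : ∀ {x y} → x ≡ y [mod + m ] → x * + r ≡ y * + r [mod + n ]
    *r-cong {x} {y} p = subst₂ (λ k N → x * k ≡ y * k [mod N ]) (sym +r≡+r′*+d) (sym +n≡+m*+d) (*-scale-mod (+ r′) (+ d) p)

    er′≡1 : + e * + r′ ≡ 1ℤ [mod + m ]
    er′≡1 = subst (_≡ 1ℤ [mod + m ]) (ℤP.pos-* e r′) (mod≡⇒≡[mod] m (e ℕ.* r′) 1 e-inverse)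

    er≡d : + e * + r ≡ + d [mod + n ]
    er≡d = subst₂ (_≡_[mod + n ]) (cong (+ e *_) (sym +r≡+r′*+d)) (ℤP.*-identityˡ (+ d)) scaled
      where
        scaled : + e * (+ r′ * + d) ≡ 1ℤ * + d [mod + n ]
        scaled = subst (λ N → + e * (+ r′ * + d) ≡ 1ℤ * + d [mod N ]) (sym +n≡+m*+d)
          (≡[mod]-trans (≡[mod]-reflexive (sym (ℤP.*-assoc (+ e) (+ r′) (+ d)))) (*-monoʳ-mod (+ d) er′≡1))

    position : ℕ × ℕ → ℕ
    position (i , j) = (+ i - + (j ℕ.* r)) zmod n

    position<n : ∀ cell → position cell ℕ.< n
    position<n (i , j) = zmod-< n (+ i - + (j ℕ.* r))

    InRange : ℕ × ℕ → Set
    InRange (i , j) = i ℕ.< d × j ℕ.< m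

    *r-mod : ∀ x → + ((x mod m) ℕ.* r) ≡ + (x ℕ.* r) [mod + n ]
    *r-mod x = subst₂ (_≡_[mod + n ]) (sym (ℤP.pos-* (x mod m) r)) (sym (ℤP.pos-* x r))
      (*r-cong (subst (λ z → + z ≡ + x [mod + m ]) (sym (mod≡zmod x m)) (zmod-≡ m (+ x))))

    position-shift : ∀ i j s → position (i , (j ℕ.+ s) mod m) ≡ (+ position (i , j) - + (s ℕ.* r)) zmod n
    position-shift i j s = zmod-cong n (begin
        + i - + (((j ℕ.+ s) mod m) ℕ.* r)        ≈⟨ -‿cong-mod (≡[mod]-refl {x = + i}) (*r-mod (j ℕ.+ s)) ⟩
        + i - + ((j ℕ.+ s) ℕ.* r)
          ≡⟨ cong (λ x → + i - x) (trans (cong +_ (ℕP.*-distribʳ-+ r j s)) (ℤP.pos-+ (j ℕ.* r) (s ℕ.* r))) ⟩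
        + i - (+ (j ℕ.* r) + + (s ℕ.* r))        ≡⟨ lemma (+ i) (+ (j ℕ.* r)) (+ (s ℕ.* r)) ⟩
        + i - + (j ℕ.* r) - + (s ℕ.* r)          ≈⟨ -‿cong-mod (zmod-≡ n (+ i - + (j ℕ.* r))) ≡[mod]-refl ⟨
        + position (i , j) - + (s ℕ.* r)         ∎)
      where
        open ≡[mod]-Reasoning (+ n)
        lemma : ∀ x y z → x - (y + z) ≡ x - y - z
        lemma = solve-∀

    position-up : ∀ i j → position (i , j) ≡ prev n (position (suc i , j))
    position-up i j = zmod-cong n (begin
        + i - + (j ℕ.* r)                        ≡⟨ lemma (+ i) (+ (j ℕ.* r)) ⟩
        + suc i - + (j ℕ.* r) - + 1              ≈⟨ -‿cong-mod (zmod-≡ n (+ suc i - + (j ℕ.* r))) ≡[mod]-refl ⟨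
        + position (suc i , j) - + 1             ∎)
      where
        open ≡[mod]-Reasoning (+ n)
        lemma : ∀ x y → x - y ≡ + 1 + x - y - + 1
        lemma = solve-∀

    position-wrap : ∀ j → position (d ∸ 1 , (j ℕ.+ e) mod m) ≡ prev n (position (0 , j))
    position-wrap j = trans (position-shift (d ∸ 1) j e) (zmod-cong n (begin
        + position (d ∸ 1 , j) - + (e ℕ.* r)
          ≈⟨ -‿cong-mod (zmod-≡ n (+ (d ∸ 1) - + (j ℕ.* r))) (≡[mod]-reflexive (ℤP.pos-* e r)) ⟩
        + (d ∸ 1) - + (j ℕ.* r) - + e * + r      ≈⟨ -‿cong-mod (≡[mod]-refl {x = + (d ∸ 1) - + (j ℕ.* r)}) er≡d ⟩
        + (d ∸ 1) - + (j ℕ.* r) - + d            ≡⟨ cong (λ x → x - + (j ℕ.* r) - + d) +[d∸1]≡ ⟩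
        + d - + 1 - + (j ℕ.* r) - + d            ≡⟨ lemma (+ d) (+ (j ℕ.* r)) ⟩
        + 0 - + (j ℕ.* r) - + 1                  ≈⟨ -‿cong-mod (zmod-≡ n (+ 0 - + (j ℕ.* r))) ≡[mod]-refl ⟨
        + position (0 , j) - + 1                 ∎))
      where
        open ≡[mod]-Reasoning (+ n)
        +[d∸1]≡ : + (d ∸ 1) ≡ + d - + 1
        +[d∸1]≡ = pos-∸ (ℕ.>-nonZero⁻¹ d)
        lemma : ∀ x y → x - + 1 - y - x ≡ + 0 - y - + 1
        lemma = solve-∀

    position-≡ : ∀ i j → + position (i , j) ≡ + i - + (j ℕ.* r) [mod + n ]
    position-≡ i j = zmod-≡ n (+ i - + (j ℕ.* r))

    *r≡0[mod-d] : ∀ j → + (j ℕ.* r) ≡ 0ℤ [mod + d ]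
    *r≡0[mod-d] j = ∣⇒≡[mod] (divides (+ j * + r′) (begin
        + (j ℕ.* r) - 0ℤ       ≡⟨ ℤP.+-identityʳ (+ (j ℕ.* r)) ⟩
        + (j ℕ.* r)            ≡⟨ ℤP.pos-* j r ⟩
        + j * + r              ≡⟨ cong (+ j *_) +r≡+r′*+d ⟩
        + j * (+ r′ * + d)     ≡⟨ ℤP.*-assoc (+ j) (+ r′) (+ d) ⟨
        + j * + r′ * + d       ∎))
      where open ≡-Reasoning

    *r-cancel : ∀ j j′ → + (j ℕ.* r) ≡ + (j′ ℕ.* r) [mod + n ] → + j ≡ + j′ [mod + m ]
    *r-cancel j j′ p = begin
        + j                  ≈⟨ ×r′e j ⟨
        + j * + r′ * + e     ≈⟨ *-congʳ-mod (+ e) (*-cancelʳ-mod {x = + j * + r′} {y = + j′ * + r′} (+ d) scaled) ⟩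
        + j′ * + r′ * + e    ≈⟨ ×r′e j′ ⟩
        + j′                 ∎
      where
        open ≡[mod]-Reasoning (+ m)
        as-r′d : ∀ x → + (x ℕ.* r) ≡ + x * + r′ * + d
        as-r′d x = trans (ℤP.pos-* x r) (trans (cong (+ x *_) +r≡+r′*+d) (sym (ℤP.*-assoc (+ x) (+ r′) (+ d))))
        scaled : + j * + r′ * + d ≡ + j′ * + r′ * + d [mod + m * + d ]
        scaled = subst₂ (_≡_[mod + m * + d ]) (as-r′d j) (as-r′d j′)
          (subst (λ N → + (j ℕ.* r) ≡ + (j′ ℕ.* r) [mod N ]) +n≡+m*+d p)
        ×r′e : ∀ x → + x * + r′ * + e ≡ + x [mod + m ]
        ×r′e x = ≡[mod]-trans (≡[mod]-reflexive (trans (ℤP.*-assoc (+ x) (+ r′) (+ e)) (cong (+ x *_) (ℤP.*-comm (+ r′) (+ e)))))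
          (≡[mod]-trans (*-congˡ-mod (+ x) er′≡1) (≡[mod]-reflexive (ℤP.*-identityʳ (+ x))))

    position-injective : ∀ {i j i′ j′} → InRange (i , j) → InRange (i′ , j′) →
                         position (i , j) ≡ position (i′ , j′) → i ≡ i′ × j ≡ j′
    position-injective {i} {j} {i′} {j′} (i<d , j<m) (i′<d , j′<m) eq = i≡i′ , j≡j′
      where
        same : + i - + (j ℕ.* r) ≡ + i′ - + (j′ ℕ.* r) [mod + n ]
        same = ≡[mod]-trans (≡[mod]-sym (position-≡ i j)) (≡[mod]-trans (≡[mod]-reflexive (cong +_ eq)) (position-≡ i′ j′))
        row : ∀ x y → x ≡ x - y + y
        row = solve-∀
        i≡i′ : i ≡ i′
        i≡i′ = ≡[mod]-small⇒≡ i<d i′<d (begin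
            + i                              ≡⟨ row (+ i) (+ (j ℕ.* r)) ⟩
            + i - + (j ℕ.* r) + + (j ℕ.* r)  ≈⟨ +-cong-mod (≡[mod]-∣ (divides (+ m) +n≡+m*+d) same) (*r≡0[mod-d] j) ⟩
            + i′ - + (j′ ℕ.* r) + 0ℤ         ≈⟨ +-cong-mod (≡[mod]-refl {x = + i′ - + (j′ ℕ.* r)}) (*r≡0[mod-d] j′) ⟨
            + i′ - + (j′ ℕ.* r) + + (j′ ℕ.* r) ≡⟨ row (+ i′) (+ (j′ ℕ.* r)) ⟨
            + i′                             ∎)
          where open ≡[mod]-Reasoning (+ d)
        column : ∀ x y → x - (x - y) ≡ y
        column = solve-∀
        j≡j′ : j ≡ j′
        j≡j′ = ≡[mod]-small⇒≡ j<m j′<m (*r-cancel j j′ (subst₂ (_≡_[mod + n ]) (column (+ i) _) (column (+ i) _)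
          (-‿cong-mod (≡[mod]-refl {x = + i}) (subst (λ x → + i - + (j ℕ.* r) ≡ + x - + (j′ ℕ.* r) [mod + n ]) (sym i≡i′) same))))

    cellOf : ℕ → ℕ × ℕ
    cellOf p = ℕD._%_ p d , (- (+ ℕD._/_ p d * + e)) zmod m

    cellOf-inRange : ∀ p → InRange (cellOf p)
    cellOf-inRange p = ℕD.m%n<n p d , zmod-< m (- (+ ℕD._/_ p d * + e))

    position-cellOf : ∀ {p} → p ℕ.< n → position (cellOf p) ≡ p
    position-cellOf {p} p<n = zmod-unique n p<n (begin
        + i - + (j ℕ.* r)          ≈⟨ -‿cong-mod (≡[mod]-refl {x = + i}) jr≡-qd ⟩
        + i - - + q * + d          ≡⟨ lemma (+ i) (+ q) (+ d) ⟩
        + i + + q * + d            ≡⟨ trans (ℤP.pos-+ i (q ℕ.* d)) (cong (_+_ (+ i)) (ℤP.pos-* q d)) ⟨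
        + (i ℕ.+ q ℕ.* d)          ≡⟨ cong +_ (ℕD.m≡m%n+[m/n]*n p d) ⟨
        + p                        ∎)
      where
        open ≡[mod]-Reasoning (+ n)
        i = ℕD._%_ p d
        q = ℕD._/_ p d
        j = (- (+ q * + e)) zmod m
        jr≡-qd : + (j ℕ.* r) ≡ - + q * + d [mod + n ]
        jr≡-qd = begin
          + (j ℕ.* r)              ≡⟨ ℤP.pos-* j r ⟩
          + j * + r                ≈⟨ *r-cong (zmod-≡ m (- (+ q * + e))) ⟩
          - (+ q * + e) * + r      ≡⟨ reassoc (+ q) (+ e) (+ r) ⟩
          - + q * (+ e * + r)      ≈⟨ *-congˡ-mod (- + q) er≡d ⟩
          - + q * + d              ∎
          where reassoc : ∀ q e r → - (q * e) * r ≡ - q * (e * r)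
                reassoc = solve-∀
        lemma : ∀ i q d → i - - q * d ≡ i + q * d
        lemma = solve-∀

    cellOf-position : ∀ {cell} → InRange cell → cellOf (position cell) ≡ cell
    cellOf-position {i , j} inRange = cong₂ _,_ (proj₁ same) (proj₂ same)
      where same = position-injective (cellOf-inRange (position (i , j))) inRange (position-cellOf (position<n (i , j)))

    β : ℕ → ℤ
    β = aK-digit n r a

    entries≡β : ∀ i j → entry n r a i ((j ℕ.+ 2) mod m) - entry n r a i ((j ℕ.+ 1) mod m) + entry n r a i j ≡ β (position (i , j))
    entries≡β i j = cong₂ (λ x y → + bit a x - + bit a y + entry n r a i j) (position-shift i j 2)
      (trans (position-shift i j 1) (cong (λ s → (+ position (i , j) - + s) zmod n) (ℕP.*-identityˡ r)))

    predCell : ℕ × ℕ → ℕ × ℕ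
    predCell (zero , j) = d ∸ 1 , (j ℕ.+ e) mod m
    predCell (suc i , j) = i , j

    position-predCell : ∀ cell → position (predCell cell) ≡ prev n (position cell)
    position-predCell (zero , j) = position-wrap j
    position-predCell (suc i , j) = position-up i j

    predCell-inRange : ∀ {cell} → InRange cell → InRange (predCell cell)
    predCell-inRange {zero , j} _ = pred<self d , mod-< (j ℕ.+ e) m
      where pred<self : ∀ x .{{_ : NonZero x}} → x ∸ 1 ℕ.< x
            pred<self (suc x) = ℕP.n<1+n x
    predCell-inRange {suc i , j} (i<d , j<m) = ℕP.<-trans (ℕP.n<1+n i) i<d , j<m

    origin-inRange : InRange (0 , 0)
    origin-inRange = ℕ.>-nonZero⁻¹ d , ℕ.>-nonZero⁻¹ m

    position-origin : position (0 , 0) ≡ 0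
    position-origin = zmod-unique n (ℕ.>-nonZero⁻¹ n) ≡[mod]-refl

    δ₀-position-off : ∀ {i j} → InRange (i , j) → ¬ (i ≡ 0 × j ≡ 0) → δ₀ (position (i , j)) ≡ 0ℤ
    δ₀-position-off {i} {j} inRange off with position (i , j) in eq
    ... | zero = ⊥-elim (off (position-injective inRange origin-inRange (trans eq (sym position-origin))))
    ... | suc _ = refl

    record Recurrence (c : ℕ → ℕ → ℤ) : Set where
      field
        trit : ∀ {cell} → InRange cell → Trit (uncurry c cell)
        step : ∀ {cell} → InRange cell →
               + 2 * uncurry c cell - uncurry c (predCell cell) ≡ β (position cell) - δ₀ (position cell)

    conditionB⇒recurrence : ∀ {c} → ConditionB n r e a c → Recurrence c
    conditionB⇒recurrence {c} (c-trit , eq₀₀ , eq₀ⱼ , eqᵢⱼ) = record { trit = λ (i<d , j<m) → c-trit _ _ i<d j<m ; step = step }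
      where
        step : ∀ {cell} → InRange cell → + 2 * uncurry c cell - uncurry c (predCell cell) ≡ β (position cell) - δ₀ (position cell)
        step {zero , zero} _ = trans (+1⇒-1 (trans eq₀₀ (entries≡β 0 0)))
          (cong (λ z → β (position (0 , 0)) - δ₀ z) (sym position-origin))
          where +1⇒-1 : ∀ {x y} → x + 1ℤ ≡ y → x ≡ y - 1ℤ
                +1⇒-1 {x} refl = sym (lemma x)
                  where lemma : ∀ x → x + 1ℤ - 1ℤ ≡ x
                        lemma = solve-∀
        step {zero , suc j} inRange@(_ , j<m) = trans (trans (eq₀ⱼ (suc j) (s≤s z≤n) j<m) (entries≡β 0 (suc j)))
          (sym (trans (cong (_-_ (β (position (0 , suc j)))) (δ₀-position-off inRange (λ ()))) (ℤP.+-identityʳ _)))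
        step {suc i , j} inRange@(i<d , j<m) = trans (trans (eqᵢⱼ (suc i) j (s≤s z≤n) i<d j<m) (entries≡β (suc i) j))
          (sym (trans (cong (_-_ (β (position (suc i , j)))) (δ₀-position-off inRange (λ ()))) (ℤP.+-identityʳ _)))

    recurrence⇒conditionB : ∀ {c} → Recurrence c → ConditionB n r e a c
    recurrence⇒conditionB {c} rec =
        (λ i j i<d j<m → trit (i<d , j<m))
      , trans (cong (_+ 1ℤ) (trans (step origin-inRange) (cong (λ z → β (position (0 , 0)) - δ₀ z) position-origin)))
              (trans (lemma (β (position (0 , 0)))) (sym (entries≡β 0 0)))
      , (λ j 1≤j j<m → trans (step (origin-row j<m))
              (trans (cong (_-_ (β (position (0 , j)))) (δ₀-position-off (origin-row j<m) (λ (_ , j≡0) → ℕP.<⇒≢ 1≤j (sym j≡0))))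
                (trans (ℤP.+-identityʳ _) (sym (entries≡β 0 j)))))
      , step-below
      where
        open Recurrence rec
        origin-row : ∀ {j} → j ℕ.< m → InRange (0 , j)
        origin-row j<m = proj₁ origin-inRange , j<m
        lemma : ∀ x → x - 1ℤ + 1ℤ ≡ x
        lemma = solve-∀
        step-below : ∀ i j → 1 ℕ.≤ i → i ℕ.< d → j ℕ.< m →
          + 2 * c i j - c (i ∸ 1) j ≡ entry n r a i ((j ℕ.+ 2) mod m) - entry n r a i ((j ℕ.+ 1) mod m) + entry n r a i j
        step-below (suc i) j _ i<d j<m = trans (step (i<d , j<m))
          (trans (cong (_-_ (β (position (suc i , j)))) (δ₀-position-off (i<d , j<m) (λ ())))
            (trans (ℤP.+-identityʳ _) (sym (entries≡β (suc i) j))))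

    carries⇒recurrence : ∀ {γ} → Carries n β γ → Recurrence (λ i j → γ (position (i , j)))
    carries⇒recurrence {γ} carries = record
      { trit = λ {cell} _ → trit (position cell) (position<n cell)
      ; step = λ {cell} _ → trans (cong (λ p → + 2 * γ (position cell) - γ p) (position-predCell cell))
                                  (step (position cell) (position<n cell))
      }
      where open Carries carries

    cellValues : (ℕ → ℕ → ℤ) → ℕ → ℤ
    cellValues c p = uncurry c (cellOf p)

    cellValues-position : ∀ c {cell} → InRange cell → uncurry c cell ≡ cellValues c (position cell)
    cellValues-position c inRange = cong (uncurry c) (sym (cellOf-position inRange))

    recurrence⇒carries : ∀ {c} → Recurrence c → Carries n β (cellValues c)
    recurrence⇒carries {c} rec = record
      { trit = λ p _ → trit (cellOf-inRange p)
      ; step = λ p p<n → trans (cong (λ cell → + 2 * cellValues c p - uncurry c cell) (cellOf-prev p<n))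
                           (trans (step (cellOf-inRange p)) (cong (λ q → β q - δ₀ q) (position-cellOf p<n)))
      }
      where
        open Recurrence rec
        cellOf-prev : ∀ {p} → p ℕ.< n → cellOf (prev n p) ≡ predCell (cellOf p)
        cellOf-prev {p} p<n = trans (cong cellOf (trans (cong (prev n) (sym (position-cellOf p<n))) (sym (position-predCell (cellOf p)))))
          (cellOf-position (predCell-inRange (cellOf-inRange p)))

open import Data.Nat using (ℕ; zero; suc; _*_; _∸_; _^_; _≤_; _<_; z≤n; s≤s)
import Data.Nat.Properties as ℕP
open import Data.Nat.GCD using (gcd)
open import Data.Integer using (ℤ)
open import Data.Product using (_×_; ∃; _,_; proj₁; proj₂)
open import Data.Empty using (⊥-elim)
open import Function.Bundles using (_⇔_; mk⇔; Equivalence)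
open import Relation.Binary.PropositionalEquality using (_≡_; module ≡-Reasoning)

open Carrying

theorem7 : (n r : ℕ) → 1 ≤ n → 1 ≤ r →
    (e : ℕ) → 1 ≤ e → e ≤ n div gcd r n →
    (e * (r div gcd r n)) mod (n div gcd r n) ≡ 1 mod (n div gcd r n) →
    (a : ℕ) → 1 ≤ a → a ≤ 2 ^ n ∸ 2 →
    (IsInverseOfK n r a ⇔ ∃ (λ (c : ℕ → ℕ → ℤ) → ConditionB n r e a c))
    × (∀ (c c′ : ℕ → ℕ → ℤ) → ConditionB n r e a c → ConditionB n r e a c′ →
        ∀ i j → i < gcd r n → j < n div gcd r n → c i j ≡ c′ i j)
theorem7 zero _ () _ _ _ _ _ _ _ _
theorem7 (suc zero) _ _ _ _ _ _ _ _ 1≤a a≤0 = ⊥-elim (ℕP.<⇒≱ 1≤a a≤0)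
theorem7 n@(suc k@(suc _)) r _ _ e _ _ e-inverse a _ a≤2^n∸2 = mk⇔ to from , unique
  -- Only e modulo n/d matters.
  where
    open Grid n r e a e-inverse
    a<2^n : a < 2 ^ n
    a<2^n = ℕP.≤-<-trans a≤2^n∸2 (ℕP.∸-monoʳ-< (s≤s z≤n) (ℕP.^-monoʳ-≤ 2 {1} {n} (s≤s z≤n)))
    ≡1⇔ = isInverseOfK⇔ n r a<2^n
    to : IsInverseOfK n r a → ∃ (ConditionB n r e a)
    to inverse = (λ i j → proj₁ carrying (position (i , j))) , recurrence⇒conditionB (carries⇒recurrence (proj₂ carrying))
      where carrying = ≡1⇒carries k β (s≤s z≤n) (λ p _ → aK-digit-bounds n r a p) (Equivalence.to ≡1⇔ inverse)
    from : ∃ (ConditionB n r e a) → IsInverseOfK n r a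
    from (c , condition) =
      Equivalence.from ≡1⇔ (carries⇒≡1 k β (cellValues c) (recurrence⇒carries (conditionB⇒recurrence condition)))
    unique : ∀ c c′ → ConditionB n r e a c → ConditionB n r e a c′ → ∀ i j → i < d → j < m → c i j ≡ c′ i j
    unique c c′ condition condition′ i j i<d j<m = begin
      c i j                           ≡⟨ cellValues-position c (i<d , j<m) ⟩
      cellValues c (position (i , j))
        ≡⟨ carries-unique n (carries c condition) (carries c′ condition′) (position (i , j)) (position<n (i , j)) ⟩
      cellValues c′ (position (i , j)) ≡⟨ cellValues-position c′ (i<d , j<m) ⟨
      c′ i j                          ∎
      where
        open ≡-Reasoning
        carries = λ c condition → recurrence⇒carries {c} (conditionB⇒recurrence condition)
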